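{- Let $G$ be a graph and let $(L,H)$ be a correspondence-cover of $G$ such that $|L(v)|\ge \deg(v)+1$ for every vertex $v$ of $G$. Then there exists a probability distribution on independent sets $I$ of $H$ such that for every $v\in V(G)$ and every $x\in L(v)$, $\Pr(x\in I)\ge 1/|L(v)|$.
   Context: A correspondence-cover of a graph $G$ is a pair $(L,H)$ where $H$ is a graph and $L:V(G)\to 2^{V(H)}$ is such that: the sets $L(v)$ (here allowed to have different sizes) partition $V(H)$; for distinct non-adjacent $u,v$ there are no edges of $H$ between $L(u)$ and $L(v)$; for $uv\in E(G)$ the edges of $H$ between $L(u)$ and $L(v)$ form a matching; each $L(v)$ induces a clique in $H$. -}

module Defs where

open import Data.Nat using (ℕ; zero; suc; _+_)
open import Data.Bool using (Bool; true; false; if_then_else_) renaming (_≟_ to _≟ᵇ_)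
open import Data.Fin using (Fin; _≟_)
open import Data.Fin.Subset using (Subset; _∈_)
open import Data.Fin.Subset.Properties using (_∈?_)
open import Data.List using (List; []; _∷_; length; filter; foldr; map)
open import Data.List.Base using (allFin)
open import Data.List.Relation.Unary.All using (All)
open import Data.Product using (_×_; _,_; proj₁; proj₂)
open import Data.Rational using (ℚ; 0ℚ; 1ℚ; _≤_) renaming (_+_ to _+ℚ_)
open import Relation.Nullary using (¬_; does)
open import Relation.Binary.PropositionalEquality using (_≡_; _≢_)

record Graph (n : ℕ) : Set where
  field
    adj    : Fin n → Fin n → Bool
    sym    : ∀ u v → adj u v ≡ adj v u
    irrefl : ∀ v → adj v v ≡ false
open Graph public

deg : ∀ {n} → Graph n → Fin n → ℕ
deg {n} G v = length (filter (λ u → adj G v u ≟ᵇ true) (allFin n))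

-- A correspondence-cover (L,H) of G.  The partition {L(v)} of V(H) = Fin m
-- is encoded by the map f : Fin m → Fin n sending each x to the unique v
-- with x ∈ L(v); so L(v) = f⁻¹(v).
record Cover {n : ℕ} (G : Graph n) : Set where
  field
    m : ℕ
    H : Graph m
    f : Fin m → Fin n
    clique   : ∀ x y → f x ≡ f y → x ≢ y → adj H x y ≡ true
    nonadj   : ∀ x y → f x ≢ f y → adj G (f x) (f y) ≡ false → adj H x y ≡ false
    -- for uv ∈ E(G), the H-edges between L(u) and L(v) form a matching
    -- (each x has at most one H-neighbour in L(w), for w ≠ f x)
    matching : ∀ x y z → f y ≢ f x → f y ≡ f z →
               adj H x y ≡ true → adj H x z ≡ true → y ≡ z
open Cover public

L : ∀ {n} {G : Graph n} (C : Cover G) → Fin n → List (Fin (m C))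
L C v = filter (λ x → f C x ≟ v) (allFin (m C))

size : ∀ {n} {G : Graph n} (C : Cover G) → Fin n → ℕ
size C v = length (L C v)

Independent : ∀ {m} → Graph m → Subset m → Set
Independent H I = ∀ x y → x ∈ I → y ∈ I → adj H x y ≡ false

record Distribution {m : ℕ} (H : Graph m) : Set where
  field
    support     : List (Subset m × ℚ)
    independent : All (λ q → Independent H (proj₁ q)) support
    nonneg      : All (λ q → 0ℚ ≤ proj₂ q) support
    total       : foldr (λ q acc → proj₂ q +ℚ acc) 0ℚ support ≡ 1ℚ
open Distribution public

Pr∈ : ∀ {m} {H : Graph m} → Distribution H → Fin m → ℚ
Pr∈ D x = foldr (λ q acc → (if does (x ∈? proj₁ q) then proj₂ q else 0ℚ) +ℚ acc) 0ℚ (support D)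

{-# OPTIONS --safe #-}
module Submission where

open import Defs hiding (sym)

-- Induction on the set A ⊆ V(H) of still available vertices, under the invariant that every
-- u with A ∩ L(u) ≠ ∅ has fewer "live" neighbours (w ~ u with A ∩ L(w) ≠ ∅) than |A ∩ L(u)|;
-- for A = V(H) this is the hypothesis |L(v)| ≥ deg(v) + 1.  Pick v maximising a = |A ∩ L(v)|.
-- For each neighbour u of v the H-edges between A ∩ L(v) and A ∩ L(u) form a matching, which
-- extends to an injection σᵤ : A ∩ L(u) → A ∩ L(v) because |A ∩ L(u)| ≤ a.  Choose x ∈ A ∩ L(v)
-- uniformly, put x into I and recurse on A minus L(v) minus {y : σ(y) = x}: this deletes every
-- H-neighbour of x, at most one vertex of each neighbouring list and kills v, so the invariant
-- survives.  If y ∈ L(u), u ~ v, and b = |A ∩ L(u)|, then y survives for the a − 1 choices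
-- x ≠ σ(y); for b − 1 of them the list of y shrinks to b − 1 and for a − b it keeps b elements,
-- so by induction Pr(y ∈ I) ≥ (1/a)((b − 1)/(b − 1) + (a − b)/b) = 1/b.  Distributions are built as lists of sets with natural-number weights and divided
-- by the total weight only at the end.

module FiniteSums where

  open import Data.Bool using (Bool; true; false; _∧_; _∨_; not)
  open import Data.Bool.Properties using (∧-conicalˡ; ∧-conicalʳ; ∧-identityʳ; ∧-zeroʳ)
  open import Data.Empty using (⊥-elim)
  open import Data.Fin using (Fin; zero; suc; _≟_)
  import Data.Fin.Properties as Fin
  open import Data.List using (filter; length; tabulate)
  open import Data.Nat using (ℕ; zero; suc; _+_; _*_; _≤_; _<_; z≤n; s≤s)
  open import Data.Nat.Properties
    using (+-*-semiring; module ≤-Reasoning; +-mono-≤; +-mono-<-≤; +-mono-≤-<; m+n≡0⇒m≡0; m+n≡0⇒n≡0;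
           m≤m+n; m≤n+m; ≤-trans; ≤-refl; ≤-reflexive; +-identityʳ; +-comm; *-zeroʳ; *-monoʳ-≤; *-assoc;
           suc-injective)
  open import Algebra.Properties.Semiring.Sum +-*-semiring
    using (sum; sum-cong-≗; sum-replicate-zero; ∑-distrib-+; ∑-comm; *-distribˡ-sum)
  open import Data.Nat.Tactic.RingSolver using (solve-∀)
  open import Data.Product using (∃; _,_)
  open import Data.Sum using (_⊎_; inj₁; inj₂)
  open import Function using (_∘_; case_of_)
  open import Level using (0ℓ)
  open import Relation.Binary.PropositionalEquality
  open import Relation.Nullary using (does; yes; no)
  open import Relation.Nullary.Decidable using (dec-true; dec-false)
  open import Relation.Unary using (Pred; Decidable)

  𝟙 : Bool → ℕ
  𝟙 true  = 1
  𝟙 false = 0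

  𝟙-mono : ∀ {a b} → (a ≡ true → b ≡ true) → 𝟙 a ≤ 𝟙 b
  𝟙-mono {false} _   = z≤n
  𝟙-mono {true}  a⇒b rewrite a⇒b refl = ≤-refl

  𝟙-pos : ∀ {b} → 0 < 𝟙 b → b ≡ true
  𝟙-pos {true} _ = refl

  𝟙-idem : ∀ b → 𝟙 b * 𝟙 b ≡ 𝟙 b
  𝟙-idem true  = refl
  𝟙-idem false = refl

  ∨-≡true : ∀ p {q} → (p ∨ q) ≡ true → p ≡ true ⊎ q ≡ true
  ∨-≡true true  _   = inj₁ refl
  ∨-≡true false p∨q = inj₂ p∨q

  ∧-false-when : ∀ p q → (q ≡ true → p ≡ false) → (p ∧ q) ≡ false
  ∧-false-when p false _   = ∧-zeroʳ p
  ∧-false-when p true  q⇒¬p = trans (∧-identityʳ p) (q⇒¬p refl)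

  ∧-congˡ-when : ∀ {p p′} q → (q ≡ true → p ≡ p′) → (p ∧ q) ≡ (p′ ∧ q)
  ∧-congˡ-when {p} {p′} false _    = trans (∧-zeroʳ p) (sym (∧-zeroʳ p′))
  ∧-congˡ-when          true  p≡p′ = cong (_∧ true) (p≡p′ refl)

  sum-mono-≤ : ∀ {k} {g h : Fin k → ℕ} → (∀ i → g i ≤ h i) → sum g ≤ sum h
  sum-mono-≤ {zero}  _   = z≤n
  sum-mono-≤ {suc k} g≤h = +-mono-≤ (g≤h zero) (sum-mono-≤ (g≤h ∘ suc))

  sum-mono-< : ∀ {k} {g h : Fin k → ℕ} j → (∀ i → g i ≤ h i) → g j < h j → sum g < sum h
  sum-mono-< zero    g≤h gj<hj = +-mono-<-≤ gj<hj (sum-mono-≤ (g≤h ∘ suc))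
  sum-mono-< (suc j) g≤h gj<hj = +-mono-≤-< (g≤h zero) (sum-mono-< j (g≤h ∘ suc) gj<hj)

  ≤-sum : ∀ {k} (g : Fin k → ℕ) j → g j ≤ sum g
  ≤-sum g zero    = m≤m+n (g zero) _
  ≤-sum g (suc j) = ≤-trans (≤-sum (g ∘ suc) j) (m≤n+m _ (g zero))

  sum≡0⇒≡0 : ∀ {k} (g : Fin k → ℕ) → sum g ≡ 0 → ∀ i → g i ≡ 0
  sum≡0⇒≡0 g Σg≡0 zero    = m+n≡0⇒m≡0 (g zero) Σg≡0
  sum≡0⇒≡0 g Σg≡0 (suc i) = sum≡0⇒≡0 (g ∘ suc) (m+n≡0⇒n≡0 (g zero) Σg≡0) i

  sum-zero : ∀ {k} {g : Fin k → ℕ} → (∀ i → g i ≡ 0) → sum g ≡ 0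
  sum-zero {k} g≡0 = trans (sum-cong-≗ g≡0) (sum-replicate-zero k)

  sum-supported : ∀ {k} (g : Fin k → ℕ) j → (∀ i → i ≢ j → g i ≡ 0) → sum g ≡ g j
  sum-supported {suc k} g zero    g≡0 = begin
    g zero + sum (g ∘ suc) ≡⟨ cong (g zero +_) (sum-zero (λ i → g≡0 (suc i) λ ())) ⟩
    g zero + 0             ≡⟨ +-identityʳ (g zero) ⟩
    g zero                 ∎
    where open ≡-Reasoning
  sum-supported {suc k} g (suc j) g≡0 =
    cong₂ _+_ (g≡0 zero λ ()) (sum-supported (g ∘ suc) j λ i i≢j → g≡0 (suc i) (i≢j ∘ Fin.suc-injective))

  _==_ : ∀ {k} → Fin k → Fin k → Bool
  i == j = does (i ≟ j)

  ==-refl : ∀ {k} (i : Fin k) → (i == i) ≡ true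
  ==-refl i = dec-true (i ≟ i) refl

  ≢⇒==-false : ∀ {k} {i j : Fin k} → i ≢ j → (i == j) ≡ false
  ≢⇒==-false {i = i} {j} = dec-false (i ≟ j)

  ==⇒≡ : ∀ {k} {i j : Fin k} → (i == j) ≡ true → i ≡ j
  ==⇒≡ {i = i} {j} i==j with i ≟ j
  ... | yes i≡j = i≡j

  sum-split-at : ∀ {k} (g : Fin k → ℕ) j → sum g ≡ g j + sum (λ i → 𝟙 (not (i == j)) * g i)
  sum-split-at g j = begin
    sum g                                  ≡⟨ sum-cong-≗ split ⟩
    sum (λ i → 𝟙 (i == j) * g i + g≠ i)    ≡⟨ ∑-distrib-+ (λ i → 𝟙 (i == j) * g i) g≠ ⟩
    sum (λ i → 𝟙 (i == j) * g i) + sum g≠  ≡⟨ cong (_+ sum g≠) (sum-supported _ j off-j) ⟩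
    𝟙 (j == j) * g j + sum g≠              ≡⟨ cong (λ b → 𝟙 b * g j + sum g≠) (==-refl j) ⟩
    g j + 0 + sum g≠                       ≡⟨ cong (_+ sum g≠) (+-identityʳ (g j)) ⟩
    g j + sum g≠                           ∎
    where
    open ≡-Reasoning
    g≠ : Fin _ → ℕ
    g≠ i = 𝟙 (not (i == j)) * g i
    off-j : ∀ i → i ≢ j → 𝟙 (i == j) * g i ≡ 0
    off-j i i≢j rewrite ≢⇒==-false i≢j = refl
    split : ∀ i → g i ≡ 𝟙 (i == j) * g i + g≠ i
    split i with i == j
    ... | true  = sym (trans (+-identityʳ (g i + 0)) (+-identityʳ (g i)))
    ... | false = sym (+-identityʳ (g i))

  count : ∀ {k} → (Fin k → Bool) → ℕ
  count P = sum (𝟙 ∘ P)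

  sum-fibres : ∀ {k l} (Q : Fin k → Bool) (P : Fin l → Bool) (σ : Fin l → Fin k) →
               (∀ {y} → P y ≡ true → Q (σ y) ≡ true) →
               sum (λ x → 𝟙 (Q x) * count (λ y → P y ∧ (σ y == x))) ≡ count P
  sum-fibres Q P σ σ-into = begin
    sum (λ x → 𝟙 (Q x) * count (λ y → P y ∧ (σ y == x)))
      ≡⟨ sum-cong-≗ (λ x → *-distribˡ-sum (𝟙 (Q x)) (λ y → 𝟙 (P y ∧ (σ y == x)))) ⟩
    sum (λ x → sum (λ y → 𝟙 (Q x) * 𝟙 (P y ∧ (σ y == x))))
      ≡⟨ ∑-comm (λ x y → 𝟙 (Q x) * 𝟙 (P y ∧ (σ y == x))) ⟩
    sum (λ y → sum (λ x → 𝟙 (Q x) * 𝟙 (P y ∧ (σ y == x))))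
      ≡⟨ sum-cong-≗ fibre ⟩
    count P ∎
    where
    open ≡-Reasoning
    fibre : ∀ y → sum (λ x → 𝟙 (Q x) * 𝟙 (P y ∧ (σ y == x))) ≡ 𝟙 (P y)
    fibre y = trans (sum-supported _ (σ y) off-fibre) on-fibre
      where
      off-fibre : ∀ x → x ≢ σ y → 𝟙 (Q x) * 𝟙 (P y ∧ (σ y == x)) ≡ 0
      off-fibre x x≢σy rewrite ≢⇒==-false (x≢σy ∘ sym) | ∧-zeroʳ (P y) = *-zeroʳ (𝟙 (Q x))
      on-fibre : 𝟙 (Q (σ y)) * 𝟙 (P y ∧ (σ y == σ y)) ≡ 𝟙 (P y)
      on-fibre rewrite ==-refl (σ y) | ∧-identityʳ (P y) with P y in Py
      ... | true  rewrite σ-into Py = refl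
      ... | false = *-zeroʳ (𝟙 (Q (σ y)))

  count-mono : ∀ {k} {P Q : Fin k → Bool} → (∀ i → P i ≡ true → Q i ≡ true) → count P ≤ count Q
  count-mono P⊆Q = sum-mono-≤ (λ i → 𝟙-mono (P⊆Q i))

  count≡0 : ∀ {k} (P : Fin k → Bool) → count P ≡ 0 → ∀ i → P i ≡ false
  count≡0 P #P≡0 i with P i | sum≡0⇒≡0 (𝟙 ∘ P) #P≡0 i
  ... | false | _ = refl

  count-witness : ∀ {k} (P : Fin k → Bool) → 0 < count P → ∃ λ i → P i ≡ true
  count-witness {suc k} P 0<#P with P zero in P0
  ... | true  = zero , P0
  ... | false = let i , Pi = count-witness (P ∘ suc) 0<#P in suc i , Pi

  empty-or-element : ∀ {k} (P : Fin k → Bool) → count P ≡ 0 ⊎ ∃ λ i → P i ≡ true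
  empty-or-element P with count P in #P
  ... | zero  = inj₁ refl
  ... | suc _ = inj₂ (count-witness P (subst (0 <_) (sym #P) (s≤s z≤n)))

  _-_ : ∀ {k} → (Fin k → Bool) → Fin k → (Fin k → Bool)
  (P - x) i = P i ∧ not (i == x)

  -⊆ : ∀ {k} (P : Fin k → Bool) x {i} → (P - x) i ≡ true → P i ≡ true
  -⊆ P x {i} = ∧-conicalˡ (P i) (not (i == x))

  -≢ : ∀ {k} (P : Fin k → Bool) x {i} → (P - x) i ≡ true → i ≢ x
  -≢ P x P-x∋x refl =
    case trans (sym (∧-conicalʳ (P x) (not (x == x)) P-x∋x)) (cong not (==-refl x)) of λ ()

  -intro : ∀ {k} (P : Fin k → Bool) x {i} → P i ≡ true → i ≢ x → (P - x) i ≡ true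
  -intro P x Pi i≢x rewrite Pi | ≢⇒==-false i≢x = refl

  count-remove : ∀ {k} (P : Fin k → Bool) {x} → P x ≡ true → count P ≡ suc (count (P - x))
  count-remove {k} P {x} Px = begin
    count P                             ≡⟨ sum-cong-≗ split ⟩
    sum (λ i → 𝟙 (i == x) + 𝟙 ((P - x) i)) ≡⟨ ∑-distrib-+ (λ i → 𝟙 (i == x)) (𝟙 ∘ (P - x)) ⟩
    count (_== x) + count (P - x)       ≡⟨ cong (_+ count (P - x)) count-singleton ⟩
    suc (count (P - x))                 ∎
    where
    open ≡-Reasoning
    split : ∀ i → 𝟙 (P i) ≡ 𝟙 (i == x) + 𝟙 ((P - x) i)
    split i with i ≟ x
    ... | yes refl rewrite Px = refl
    ... | no _     rewrite ∧-identityʳ (P i) = refl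
    count-singleton : count (_== x) ≡ 1
    count-singleton = trans (sum-supported (λ i → 𝟙 (i == x)) x (λ i i≢x → cong 𝟙 (≢⇒==-false i≢x)))
                            (cong 𝟙 (==-refl x))

  count≤1 : ∀ {k} (P : Fin k → Bool) → (∀ i j → P i ≡ true → P j ≡ true → i ≡ j) → count P ≤ 1
  count≤1 P unique with empty-or-element P
  ... | inj₁ #P≡0      = ≤-trans (≤-reflexive #P≡0) z≤n
  ... | inj₂ (x , Px) = ≤-reflexive (trans (count-remove P Px) (cong suc (sum-zero P-x≡∅)))
    where
    P-x≡∅ : ∀ i → 𝟙 ((P - x) i) ≡ 0
    P-x≡∅ i with P i in Pi | i ≟ x
    ... | false | _       = refl
    ... | true  | yes _   = refl
    ... | true  | no i≢x = ⊥-elim (i≢x (unique i x Pi Px))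

  length-filter-tabulate : ∀ {A : Set} {k} (g : Fin k → A) {P : Pred A 0ℓ} (P? : Decidable P) →
                           length (filter P? (tabulate g)) ≡ count (λ i → does (P? (g i)))
  length-filter-tabulate {k = zero}  g P? = refl
  length-filter-tabulate {k = suc k} g P? with does (P? (g zero))
  ... | true  = cong suc (length-filter-tabulate (g ∘ suc) P?)
  ... | false = length-filter-tabulate (g ∘ suc) P?

  *-monoʳ-≤-when-pos : ∀ k {a b} → (0 < k → a ≤ b) → k * a ≤ k * b
  *-monoʳ-≤-when-pos zero    _   = z≤n
  *-monoʳ-≤-when-pos (suc k) a≤b = *-monoʳ-≤ (suc k) (a≤b (s≤s z≤n))

  -- 1/(b + 1 − h) = (b + h)/((b + 1)·b) for h ∈ {0, 1}, with the denominators cleared.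
  reciprocal-bound : ∀ {W Y a′ h b} → a′ + h ≡ suc b → h ≤ 1 → W ≤ a′ * Y → (b + h) * W ≤ suc b * b * Y
  reciprocal-bound {W} {Y} {a′} {zero} {b} a′+0≡1+b _ W≤a′Y = begin
    (b + 0) * W     ≡⟨ cong (_* W) (+-identityʳ b) ⟩
    b * W           ≤⟨ *-monoʳ-≤ b W≤a′Y ⟩
    b * (a′ * Y)    ≡⟨ cong (λ a → b * (a * Y)) (trans (sym (+-identityʳ a′)) a′+0≡1+b) ⟩
    b * (suc b * Y) ≡⟨ rearrange b Y ⟩
    suc b * b * Y   ∎
    where
    open ≤-Reasoning
    rearrange : ∀ b Y → b * (suc b * Y) ≡ suc b * b * Y
    rearrange = solve-∀
  reciprocal-bound {W} {Y} {a′} {suc zero} {b} a′+1≡1+b _ W≤a′Y = begin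
    (b + 1) * W     ≡⟨ cong (_* W) (+-comm b 1) ⟩
    suc b * W       ≤⟨ *-monoʳ-≤ (suc b) W≤a′Y ⟩
    suc b * (a′ * Y) ≡⟨ cong (λ a → suc b * (a * Y)) (suc-injective (trans (+-comm 1 a′) a′+1≡1+b)) ⟩
    suc b * (b * Y) ≡⟨ sym (*-assoc (suc b) b Y) ⟩
    suc b * b * Y   ∎
    where open ≤-Reasoning
  reciprocal-bound {h = suc (suc _)} _ (s≤s ())

module Matchings where

  open FiniteSums
  open import Data.Bool using (Bool; true; _∧_) renaming (_≟_ to _≟ᵇ_)
  open import Data.Bool.Properties using (∧-conicalˡ; ∧-conicalʳ)
  open import Data.Empty using (⊥-elim)
  open import Data.Fin using (Fin; _≟_)
  open import Data.Fin.Properties using (any?)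
  open import Data.Nat using (ℕ; zero; suc; _≤_; _<_; z≤n; s≤s)
  open import Data.Nat.Properties using (≤-trans; suc-injective; ≤-pred)
  open import Data.Product using (∃₂; _×_; _,_; proj₁; proj₂)
  open import Function using (_∘_)
  open import Relation.Binary.PropositionalEquality
  open import Relation.Nullary using (yes; no)

  module _ {m : ℕ} (E : Fin m → Fin m → Bool) where

    record Matching (X Y : Fin m → Bool) : Set where
      field
        unique-right : ∀ {x y y′} → X x ≡ true → Y y ≡ true → Y y′ ≡ true →
                       E x y ≡ true → E x y′ ≡ true → y ≡ y′
        unique-left  : ∀ {x x′ y} → X x ≡ true → X x′ ≡ true → Y y ≡ true →
                       E x y ≡ true → E x′ y ≡ true → x ≡ x′

    record ExtendingInjection (X Y : Fin m → Bool) : Set where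
      field
        σ           : Fin m → Fin m
        σ-into      : ∀ {y} → Y y ≡ true → X (σ y) ≡ true
        σ-injective : ∀ {y y′} → Y y ≡ true → Y y′ ≡ true → σ y ≡ σ y′ → y ≡ y′
        σ-extends   : ∀ {x y} → X x ≡ true → Y y ≡ true → E x y ≡ true → σ y ≡ x

    Detachable : (X Y : Fin m → Bool) → Fin m → Fin m → Set
    Detachable X Y x₀ y₀ = ∀ {x y} → X x ≡ true → Y y ≡ true → E x y ≡ true →
                           (x ≡ x₀ → y ≡ y₀) × (y ≡ y₀ → x ≡ x₀)

    matching-remove : ∀ {X Y} x₀ y₀ → Matching X Y → Matching (X - x₀) (Y - y₀)
    matching-remove {X} {Y} x₀ y₀ M = record
      { unique-right = λ Xx Yy Yy′ → unique-right (-⊆ X x₀ Xx) (-⊆ Y y₀ Yy) (-⊆ Y y₀ Yy′)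
      ; unique-left  = λ Xx Xx′ Yy → unique-left (-⊆ X x₀ Xx) (-⊆ X x₀ Xx′) (-⊆ Y y₀ Yy)
      }
      where open Matching M

    detachable-pair : ∀ {X Y} → Matching X Y → 0 < count Y → count Y ≤ count X →
                      ∃₂ λ x₀ y₀ → X x₀ ≡ true × Y y₀ ≡ true × Detachable X Y x₀ y₀
    detachable-pair {X} {Y} M 0<#Y #Y≤#X
      with any? (λ x → any? (λ y → (X x ∧ Y y ∧ E x y) ≟ᵇ true))
    ... | yes (x₀ , y₀ , edge) = x₀ , y₀ , Xx₀ , Yy₀ , detached
      where
      open Matching M
      Xx₀ = ∧-conicalˡ (X x₀) _ edge
      Yy₀ = ∧-conicalˡ (Y y₀) _ (∧-conicalʳ (X x₀) _ edge)
      Ex₀y₀ = ∧-conicalʳ (Y y₀) _ (∧-conicalʳ (X x₀) _ edge)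
      detached : Detachable X Y x₀ y₀
      detached Xx Yy Exy = (λ { refl → unique-right Xx Yy Yy₀ Exy Ex₀y₀ })
                         , (λ { refl → unique-left Xx Xx₀ Yy Exy Ex₀y₀ })
    ... | no no-edge with count-witness X (≤-trans 0<#Y #Y≤#X) | count-witness Y 0<#Y
    ...   | x₀ , Xx₀ | y₀ , Yy₀ = x₀ , y₀ , Xx₀ , Yy₀ , λ Xx Yy Exy → ⊥-elim (no-edge (_ , _ , edge Xx Yy Exy))
      where
      edge : ∀ {x y} → X x ≡ true → Y y ≡ true → E x y ≡ true → (X x ∧ Y y ∧ E x y) ≡ true
      edge Xx Yy Exy rewrite Xx | Yy | Exy = refl

    extend-injection : ∀ {X Y x₀ y₀} → X x₀ ≡ true → Y y₀ ≡ true → Detachable X Y x₀ y₀ →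
                       ExtendingInjection (X - x₀) (Y - y₀) → ExtendingInjection X Y
    extend-injection {X} {Y} {x₀} {y₀} Xx₀ Yy₀ detached I = record
      { σ = σ′ ; σ-into = σ′-into ; σ-injective = σ′-injective ; σ-extends = σ′-extends }
      where
      open ExtendingInjection I
      Y-y₀ : ∀ {y} → Y y ≡ true → y ≢ y₀ → (Y - y₀) y ≡ true
      Y-y₀ = -intro Y y₀
      σ≢x₀ : ∀ {y} → Y y ≡ true → y ≢ y₀ → σ y ≢ x₀
      σ≢x₀ Yy y≢y₀ = -≢ X x₀ (σ-into (Y-y₀ Yy y≢y₀))

      σ′ : Fin m → Fin m
      σ′ y with y ≟ y₀
      ... | yes _ = x₀
      ... | no _  = σ y

      σ′-into : ∀ {y} → Y y ≡ true → X (σ′ y) ≡ true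
      σ′-into {y} Yy with y ≟ y₀
      ... | yes _    = Xx₀
      ... | no y≢y₀ = -⊆ X x₀ (σ-into (Y-y₀ Yy y≢y₀))

      σ′-injective : ∀ {y y′} → Y y ≡ true → Y y′ ≡ true → σ′ y ≡ σ′ y′ → y ≡ y′
      σ′-injective {y} {y′} Yy Yy′ eq with y ≟ y₀ | y′ ≟ y₀
      ... | yes y≡y₀ | yes y′≡y₀ = trans y≡y₀ (sym y′≡y₀)
      ... | yes _     | no y′≢y₀ = ⊥-elim (σ≢x₀ Yy′ y′≢y₀ (sym eq))
      ... | no y≢y₀  | yes _     = ⊥-elim (σ≢x₀ Yy y≢y₀ eq)
      ... | no y≢y₀  | no y′≢y₀ = σ-injective (Y-y₀ Yy y≢y₀) (Y-y₀ Yy′ y′≢y₀) eq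

      σ′-extends : ∀ {x y} → X x ≡ true → Y y ≡ true → E x y ≡ true → σ′ y ≡ x
      σ′-extends {x} {y} Xx Yy Exy with y ≟ y₀
      ... | yes y≡y₀ = sym (proj₂ (detached Xx Yy Exy) y≡y₀)
      ... | no y≢y₀  = σ-extends (-intro X x₀ Xx (y≢y₀ ∘ proj₁ (detached Xx Yy Exy))) (Y-y₀ Yy y≢y₀) Exy

    matching-injection : ∀ {X Y} → count Y ≤ count X → Matching X Y → ExtendingInjection X Y
    matching-injection = go _ refl
      where
      go : ∀ n {X Y} → count Y ≡ n → count Y ≤ count X → Matching X Y → ExtendingInjection X Y
      go zero {X} {Y} #Y≡0 _ _ = record
        { σ = λ y → y
        ; σ-into = λ Yy → absurd Yy
        ; σ-injective = λ Yy _ _ → absurd Yy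
        ; σ-extends = λ _ Yy _ → absurd Yy
        }
        where
        absurd : ∀ {A : Set} {y} → Y y ≡ true → A
        absurd {y = y} Yy with () ← trans (sym Yy) (count≡0 Y #Y≡0 y)
      go (suc n) {X} {Y} #Y≡1+n #Y≤#X M
        with detachable-pair M (subst (0 <_) (sym #Y≡1+n) (s≤s z≤n)) #Y≤#X
      ... | x₀ , y₀ , Xx₀ , Yy₀ , detached =
        extend-injection Xx₀ Yy₀ detached (go n #Y-y₀≡n #Y-y₀≤#X-x₀ (matching-remove x₀ y₀ M))
        where
        #Y-y₀≡n : count (Y - y₀) ≡ n
        #Y-y₀≡n = suc-injective (trans (sym (count-remove Y Yy₀)) #Y≡1+n)
        #Y-y₀≤#X-x₀ : count (Y - y₀) ≤ count (X - x₀)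
        #Y-y₀≤#X-x₀ = ≤-pred (subst₂ _≤_ (count-remove Y Yy₀) (count-remove X Xx₀) #Y≤#X)

module Families where

  open FiniteSums
  open import Data.Bool using (Bool; false; _∨_)
  open import Data.Bool.Properties using (∨-zeroʳ)
  open import Data.Fin using (Fin; zero; suc)
  open import Data.List using (List; []; _∷_; _++_; map)
  open import Data.List.Relation.Unary.All using (All; []; _∷_)
  import Data.List.Relation.Unary.All.Properties as All
  open import Data.Nat using (ℕ; zero; suc; _+_; _*_; _≤_; _<_; s≤s; z≤n)
  open import Data.Nat.Properties
    using (+-*-semiring; module ≤-Reasoning; *-zeroʳ; +-identityʳ; *-monoˡ-≤; *-distribˡ-+; +-assoc;
           +-mono-≤; *-monoʳ-≤; *-mono-<)
  open import Algebra.Properties.Semiring.Sum +-*-semiring using (sum)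
  open import Data.Nat.Tactic.RingSolver using (solve-∀)
  open import Data.Product using (_×_; _,_; proj₁; map₁; map₂)
  open import Function using (_∘_)
  open import Relation.Binary.PropositionalEquality

  -- A finitely supported distribution of subsets of Fin m with unnormalised weights:
  -- the probability that y lies in the random set is massAt y F / mass F.
  Family : ℕ → Set
  Family m = List ((Fin m → Bool) × ℕ)

  module _ {m : ℕ} where

    mass : Family m → ℕ
    mass []            = 0
    mass ((_ , w) ∷ F) = w + mass F

    massAt : Fin m → Family m → ℕ
    massAt y []            = 0
    massAt y ((I , w) ∷ F) = 𝟙 (I y) * w + massAt y F

    scale : ℕ → Family m → Family m
    scale s = map (map₂ (s *_))

    mass-scale : ∀ s F → mass (scale s F) ≡ s * mass F
    mass-scale s []            = sym (*-zeroʳ s)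
    mass-scale s ((_ , w) ∷ F) = trans (cong (s * w +_) (mass-scale s F)) (sym (*-distribˡ-+ s w (mass F)))

    massAt-scale : ∀ s y F → massAt y (scale s F) ≡ s * massAt y F
    massAt-scale s y []            = sym (*-zeroʳ s)
    massAt-scale s y ((I , w) ∷ F) =
      trans (cong (𝟙 (I y) * (s * w) +_) (massAt-scale s y F)) (lemma (𝟙 (I y)) s w (massAt y F))
      where
      lemma : ∀ a s w r → a * (s * w) + s * r ≡ s * (a * w + r)
      lemma = solve-∀

    mass-++ : ∀ F F′ → mass (F ++ F′) ≡ mass F + mass F′
    mass-++ []            F′ = refl
    mass-++ ((_ , w) ∷ F) F′ = trans (cong (w +_) (mass-++ F F′)) (sym (+-assoc w _ _))

    massAt-++ : ∀ y F F′ → massAt y (F ++ F′) ≡ massAt y F + massAt y F′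
    massAt-++ y []            F′ = refl
    massAt-++ y ((I , w) ∷ F) F′ =
      trans (cong (𝟙 (I y) * w +_) (massAt-++ y F F′)) (sym (+-assoc (𝟙 (I y) * w) _ _))

    Π-mass : ∀ {k} → (Fin k → Family m) → ℕ
    Π-mass {zero}  Fs = 1
    Π-mass {suc k} Fs = mass (Fs zero) * Π-mass (Fs ∘ suc)

    -- The mixture Σᵢ lᵢ · Fᵢ / mass Fᵢ, multiplied by Π-mass Fs to keep the weights natural.
    mix : ∀ {k} → (Fin k → ℕ) → (Fin k → Family m) → Family m
    mix {zero}  l Fs = []
    mix {suc k} l Fs =
      scale (l zero * Π-mass (Fs ∘ suc)) (Fs zero) ++ scale (mass (Fs zero)) (mix (l ∘ suc) (Fs ∘ suc))

    Π-mass-pos : ∀ {k} (Fs : Fin k → Family m) → (∀ i → 0 < mass (Fs i)) → 0 < Π-mass Fs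
    Π-mass-pos {zero}  Fs pos = s≤s z≤n
    Π-mass-pos {suc k} Fs pos = *-mono-< (pos zero) (Π-mass-pos (Fs ∘ suc) (pos ∘ suc))

    mass-mix : ∀ {k} (l : Fin k → ℕ) Fs → mass (mix l Fs) ≡ Π-mass Fs * sum l
    mass-mix {zero}  l Fs = refl
    mass-mix {suc k} l Fs = begin
      mass (scale (l₀ * S) F₀ ++ scale W₀ rest)
        ≡⟨ mass-++ (scale (l₀ * S) F₀) (scale W₀ rest) ⟩
      mass (scale (l₀ * S) F₀) + mass (scale W₀ rest)
        ≡⟨ cong₂ _+_ (mass-scale (l₀ * S) F₀) (mass-scale W₀ rest) ⟩
      l₀ * S * W₀ + W₀ * mass rest
        ≡⟨ cong (λ r → l₀ * S * W₀ + W₀ * r) (mass-mix (l ∘ suc) (Fs ∘ suc)) ⟩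
      l₀ * S * W₀ + W₀ * (S * sum (l ∘ suc))
        ≡⟨ lemma l₀ S W₀ (sum (l ∘ suc)) ⟩
      W₀ * S * (l₀ + sum (l ∘ suc)) ∎
      where
      open ≡-Reasoning
      l₀ = l zero
      F₀ = Fs zero
      W₀ = mass F₀
      S = Π-mass (Fs ∘ suc)
      rest = mix (l ∘ suc) (Fs ∘ suc)
      lemma : ∀ l₀ S W₀ r → l₀ * S * W₀ + W₀ * (S * r) ≡ W₀ * S * (l₀ + r)
      lemma = solve-∀

    massAt-mix : ∀ {k} (l e : Fin k → ℕ) Fs y c →
                 (∀ i → 0 < l i → e i * mass (Fs i) ≤ c * massAt y (Fs i)) →
                 Π-mass Fs * sum (λ i → l i * e i) ≤ c * massAt y (mix l Fs)
    massAt-mix {zero}  l e Fs y c bound = z≤n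
    massAt-mix {suc k} l e Fs y c bound = begin
      W₀ * S * (l₀ * e₀ + sum (λ i → l (suc i) * e (suc i)))
        ≡⟨ lemma₁ l₀ S W₀ e₀ _ ⟩
      l₀ * (S * (e₀ * W₀)) + W₀ * (S * sum (λ i → l (suc i) * e (suc i)))
        ≤⟨ +-mono-≤ (*-monoʳ-≤-when-pos l₀ (*-monoʳ-≤ S ∘ bound zero))
                    (*-monoʳ-≤ W₀ (massAt-mix (l ∘ suc) (e ∘ suc) (Fs ∘ suc) y c (bound ∘ suc))) ⟩
      l₀ * (S * (c * massAt y F₀)) + W₀ * (c * massAt y rest)
        ≡⟨ lemma₂ l₀ S W₀ c _ _ ⟩
      c * (l₀ * S * massAt y F₀ + W₀ * massAt y rest)
        ≡⟨ cong (c *_) (sym (cong₂ _+_ (massAt-scale (l₀ * S) y F₀) (massAt-scale W₀ y rest))) ⟩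
      c * (massAt y (scale (l₀ * S) F₀) + massAt y (scale W₀ rest))
        ≡⟨ cong (c *_) (sym (massAt-++ y (scale (l₀ * S) F₀) (scale W₀ rest))) ⟩
      c * massAt y (mix l Fs) ∎
      where
      open ≤-Reasoning
      l₀ = l zero
      e₀ = e zero
      F₀ = Fs zero
      W₀ = mass F₀
      S = Π-mass (Fs ∘ suc)
      rest = mix (l ∘ suc) (Fs ∘ suc)
      lemma₁ : ∀ l₀ S W₀ e₀ r → W₀ * S * (l₀ * e₀ + r) ≡ l₀ * (S * (e₀ * W₀)) + W₀ * (S * r)
      lemma₁ = solve-∀
      lemma₂ : ∀ l₀ S W₀ c a r → l₀ * (S * (c * a)) + W₀ * (c * r) ≡ c * (l₀ * S * a + W₀ * r)
      lemma₂ = solve-∀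

    All-mix : ∀ {k} {P : (Fin m → Bool) → Set} (l : Fin k → ℕ) Fs →
              (∀ i → All (P ∘ proj₁) (Fs i)) → All (P ∘ proj₁) (mix l Fs)
    All-mix {zero}  l Fs all = []
    All-mix {suc k} l Fs all =
      All.++⁺ (All.map⁺ (all zero)) (All.map⁺ (All-mix (l ∘ suc) (Fs ∘ suc) (all ∘ suc)))

    insert : Fin m → Family m → Family m
    insert x = map (map₁ (λ I z → (z == x) ∨ I z))

    mass-insert : ∀ x F → mass (insert x F) ≡ mass F
    mass-insert x []            = refl
    mass-insert x ((_ , w) ∷ F) = cong (w +_) (mass-insert x F)

    massAt-insert-self : ∀ x F → massAt x (insert x F) ≡ mass F
    massAt-insert-self x []            = refl
    massAt-insert-self x ((_ , w) ∷ F) rewrite ==-refl x = cong₂ _+_ (+-identityʳ w) (massAt-insert-self x F)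

    massAt-insert-mono : ∀ x y F → massAt y F ≤ massAt y (insert x F)
    massAt-insert-mono x y []            = z≤n
    massAt-insert-mono x y ((I , w) ∷ F) =
      +-mono-≤ (*-monoˡ-≤ w (𝟙-mono λ Iy → trans (cong ((y == x) ∨_) Iy) (∨-zeroʳ (y == x))))
               (massAt-insert-mono x y F)

    ∅-family : Family m
    ∅-family = ((λ _ → false) , 1) ∷ []

module Normalisation where

  open Families using (Family; mass; massAt)
  open import Data.Bool using (Bool; true; false; if_then_else_)
  open import Data.Fin using (Fin)
  open import Data.Fin.Subset using (Subset; _∈_)
  open import Data.Fin.Subset.Properties using (_∈?_)
  open import Data.Integer as ℤ using (+_)
  import Data.Integer.Properties as ℤ
  open import Data.Integer.Tactic.RingSolver using (solve-∀)
  open import Data.List using (List; []; _∷_; map; foldr)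
  open import Data.List.Relation.Unary.All using (All; []; _∷_)
  open import Data.Nat as ℕ using (ℕ; suc; pred; >-nonZero)
  import Data.Nat.Properties as ℕ
  open import Data.Product using (_×_; _,_; proj₁; proj₂) renaming (map to ×-map)
  open import Data.Rational using (ℚ; _/_; 0ℚ; 1ℚ; toℚᵘ; _+_; _*_; _≤_)
  open import Data.Rational.Properties
    using (toℚᵘ-fromℚᵘ; toℚᵘ-injective; toℚᵘ-homo-+; toℚᵘ-homo-*; toℚᵘ-cancel-≤; 0/n≡0; +-identityˡ)
  open import Data.Rational.Unnormalised as ℚᵘ using (mkℚᵘ; *≡*; *≤*)
  import Data.Rational.Unnormalised.Properties as ℚᵘ
  import Data.Vec as Vec
  import Data.Vec.Properties as Vec
  open import Function using (_∘_; case_of_)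
  open import Relation.Binary.PropositionalEquality
  open import Relation.Nullary using (does)
  open import Relation.Nullary.Decidable using (dec-true; dec-false)

  -- frac a d = a/(d + 1); shifting the denominator avoids NonZero instance arguments.
  frac : ℕ → ℕ → ℚ
  frac a d = (+ a) / suc d

  private
    toℚᵘ-frac : ∀ a d → toℚᵘ (frac a d) ℚᵘ.≃ mkℚᵘ (+ a) d
    toℚᵘ-frac a d = toℚᵘ-fromℚᵘ (mkℚᵘ (+ a) d)

  frac-+ : ∀ a b d → frac a d + frac b d ≡ frac (a ℕ.+ b) d
  frac-+ a b d = toℚᵘ-injective (begin
    toℚᵘ (frac a d + frac b d)              ≈⟨ toℚᵘ-homo-+ (frac a d) (frac b d) ⟩
    toℚᵘ (frac a d) ℚᵘ.+ toℚᵘ (frac b d)    ≈⟨ ℚᵘ.+-cong (toℚᵘ-frac a d) (toℚᵘ-frac b d) ⟩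
    mkℚᵘ (+ a) d ℚᵘ.+ mkℚᵘ (+ b) d          ≈⟨ *≡* cross-multiplied ⟩
    mkℚᵘ (+ (a ℕ.+ b)) d                    ≈⟨ ℚᵘ.≃-sym (toℚᵘ-frac (a ℕ.+ b) d) ⟩
    toℚᵘ (frac (a ℕ.+ b) d)                 ∎)
    where
    open ℚᵘ.≃-Reasoning
    lemma : ∀ a b d → (a ℤ.* d ℤ.+ b ℤ.* d) ℤ.* d ≡ (a ℤ.+ b) ℤ.* (d ℤ.* d)
    lemma = solve-∀
    cross-multiplied = trans (lemma (+ a) (+ b) (+ suc d))
                             (cong₂ ℤ._*_ (sym (ℤ.pos-+ a b)) (sym (ℤ.pos-* (suc d) (suc d))))

  frac-*ˡ : ∀ s a d → frac s 0 * frac a d ≡ frac (s ℕ.* a) d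
  frac-*ˡ s a d = toℚᵘ-injective (begin
    toℚᵘ (frac s 0 * frac a d)             ≈⟨ toℚᵘ-homo-* (frac s 0) (frac a d) ⟩
    toℚᵘ (frac s 0) ℚᵘ.* toℚᵘ (frac a d)   ≈⟨ ℚᵘ.*-cong (toℚᵘ-frac s 0) (toℚᵘ-frac a d) ⟩
    mkℚᵘ (+ s) 0 ℚᵘ.* mkℚᵘ (+ a) d         ≈⟨ *≡* cross-multiplied ⟩
    mkℚᵘ (+ (s ℕ.* a)) d                   ≈⟨ ℚᵘ.≃-sym (toℚᵘ-frac (s ℕ.* a) d) ⟩
    toℚᵘ (frac (s ℕ.* a) d)                ∎)
    where
    open ℚᵘ.≃-Reasoning
    cross-multiplied = cong₂ ℤ._*_ (sym (ℤ.pos-* s a)) (cong (λ k → + suc k) (sym (ℕ.+-identityʳ d)))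

  frac-zero : ∀ d → frac 0 d ≡ 0ℚ
  frac-zero d = 0/n≡0 (suc d)

  frac-self : ∀ d → frac (suc d) d ≡ 1ℚ
  frac-self d = toℚᵘ-injective (ℚᵘ.≃-trans (toℚᵘ-frac (suc d) d)
    (*≡* (trans (ℤ.*-identityʳ (+ suc d)) (sym (ℤ.*-identityˡ (+ suc d))))))

  frac-mono : ∀ {a b} d → a ℕ.≤ b → frac a d ≤ frac b d
  frac-mono {a} {b} d a≤b = toℚᵘ-cancel-≤ (ℚᵘ.≤-respʳ-≃ (ℚᵘ.≃-sym (toℚᵘ-frac b d))
    (ℚᵘ.≤-respˡ-≃ (ℚᵘ.≃-sym (toℚᵘ-frac a d)) (*≤* (ℤ.*-monoʳ-≤-nonNeg (+ suc d) (ℤ.+≤+ a≤b)))))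

  Independentᵇ : ∀ {m} → Graph m → (Fin m → Bool) → Set
  Independentᵇ H I = ∀ {x y} → I x ≡ true → I y ≡ true → adj H x y ≡ false

  module _ {m : ℕ} where

    toSubset : (Fin m → Bool) → Subset m
    toSubset = Vec.tabulate

    ∈-toSubset : ∀ I {x} → x ∈ toSubset I → I x ≡ true
    ∈-toSubset I {x} x∈I = trans (sym (Vec.lookup∘tabulate I x)) (Vec.[]=⇒lookup x∈I)

    does-∈?-toSubset : ∀ I x → does (x ∈? toSubset I) ≡ I x
    does-∈?-toSubset I x with I x in Ix
    ... | true  = dec-true (x ∈? toSubset I)
                    (Vec.lookup⇒[]= x (toSubset I) (trans (Vec.lookup∘tabulate I x) Ix))
    ... | false = dec-false (x ∈? toSubset I) λ x∈I → case trans (sym (∈-toSubset I x∈I)) Ix of λ ()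

    normalise : ℕ → Family m → List (Subset m × ℚ)
    normalise d = map (×-map toSubset (λ w → frac w d))

    total-normalise : ∀ d F → foldr (λ q acc → proj₂ q + acc) 0ℚ (normalise d F) ≡ frac (mass F) d
    total-normalise d []            = sym (frac-zero d)
    total-normalise d ((_ , w) ∷ F) =
      trans (cong (_+_ (frac w d)) (total-normalise d F)) (frac-+ w (mass F) d)

    Pr-normalise : ∀ d x F →
      foldr (λ q acc → (if does (x ∈? proj₁ q) then proj₂ q else 0ℚ) + acc) 0ℚ (normalise d F)
        ≡ frac (massAt x F) d
    Pr-normalise d x []            = sym (frac-zero d)
    Pr-normalise d x ((I , w) ∷ F) rewrite Pr-normalise d x F | does-∈?-toSubset I x with I x
    ... | true  = trans (frac-+ w (massAt x F) d)
                        (cong (λ k → frac (k ℕ.+ massAt x F) d) (sym (ℕ.+-identityʳ w)))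
    ... | false = +-identityˡ (frac (massAt x F) d)

    denominator : Family m → ℕ
    denominator F = pred (mass F)

    mass≡1+denominator : ∀ F → 0 ℕ.< mass F → mass F ≡ suc (denominator F)
    mass≡1+denominator F 0<mass = sym (ℕ.suc-pred (mass F) {{>-nonZero 0<mass}})

    distribution : ∀ {H : Graph m} (F : Family m) → 0 ℕ.< mass F → All (Independentᵇ H ∘ proj₁) F →
                   Distribution H
    distribution {H} F 0<mass indep = record
      { support     = normalise d F
      ; independent = independent′ F indep
      ; nonneg      = nonneg′ F
      ; total       = trans (total-normalise d F)
                            (trans (cong (λ k → frac k d) (mass≡1+denominator F 0<mass)) (frac-self d))
      }
      where
      d = denominator F
      independent′ : ∀ F → All (Independentᵇ H ∘ proj₁) F →
                     All (λ q → Independent H (proj₁ q)) (normalise d F)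
      independent′ []            []                = []
      independent′ ((I , _) ∷ F) (I-indep ∷ indep) =
        (λ x y x∈I y∈I → I-indep (∈-toSubset I x∈I) (∈-toSubset I y∈I)) ∷ independent′ F indep
      nonneg′ : ∀ F → All (λ q → 0ℚ ≤ proj₂ q) (normalise d F)
      nonneg′ []            = []
      nonneg′ ((_ , w) ∷ F) = subst (_≤ frac w d) (frac-zero d) (frac-mono {0} {w} d ℕ.z≤n) ∷ nonneg′ F

    distribution-Pr∈ : ∀ {H : Graph m} F 0<mass indep {x s} → mass F ℕ.≤ s ℕ.* massAt x F →
                       1ℚ ≤ frac s 0 * Pr∈ (distribution {H} F 0<mass indep) x
    distribution-Pr∈ F 0<mass indep {x} {s} mass≤ = subst₂ _≤_ (frac-self d)
      (sym (trans (cong (frac s 0 *_) (Pr-normalise d x F)) (frac-*ˡ s (massAt x F) d)))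
      (frac-mono d (subst (ℕ._≤ s ℕ.* massAt x F) (mass≡1+denominator F 0<mass) mass≤))
      where d = denominator F

module Construction {n} (G : Graph n) (C : Cover G) where

  open FiniteSums
  open Matchings
  open Families
  open Normalisation using (Independentᵇ)
  open import Data.Bool using (Bool; true; false; _∧_; _∨_; not) renaming (_≟_ to _≟ᵇ_)
  open import Data.Bool.Properties using (∧-conicalˡ; ∧-conicalʳ; ∧-zeroʳ; ∧-identityʳ; T-≡; ¬-not)
  open import Data.Fin using (Fin; _≟_)
  open import Data.List using (allFin; []; _∷_)
  open import Data.List.Extrema.Nat using (argmax; f[xs]≤f[argmax])
  open import Data.List.Membership.Propositional.Properties using (∈-allFin)
  open import Data.List.Relation.Unary.All as All using (All; []; _∷_)
  import Data.List.Relation.Unary.All.Properties as All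
  open import Data.Nat using (ℕ; zero; suc; pred; _+_; _*_; _≤_; _<_; _<ᵇ_; z≤n; s≤s; >-nonZero)
  open import Data.Nat.Properties
    using (+-*-semiring; *-commutativeSemigroup; module ≤-Reasoning; ≤-refl; ≤-reflexive; ≤-trans; ≤-antisym;
           ≤-pred; <-irrefl; <⇒<ᵇ; n≤0⇒n≡0; suc-pred; +-comm; +-cancelˡ-≡; +-monoʳ-≤; *-comm; *-assoc;
           *-identityˡ; *-identityʳ; *-zeroʳ; *-distribˡ-+; *-mono-<; *-monoʳ-≤; *-monoˡ-≤; *-cancelˡ-≤)
  open import Algebra.Properties.CommutativeSemigroup *-commutativeSemigroup using (x∙yz≈y∙xz)
  open import Algebra.Properties.Semiring.Sum +-*-semiring using (sum; sum-cong-≗; ∑-distrib-+; *-distribˡ-sum)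
  open import Data.Product using (_,_; proj₁)
  open import Data.Sum using (_⊎_; inj₁; inj₂)
  open import Function using (_∘_; case_of_; Equivalence)
  open import Relation.Binary.PropositionalEquality
  open import Relation.Nullary using (does; yes; no)

  _∩L_ : (Fin (m C) → Bool) → Fin n → Fin (m C) → Bool
  (A ∩L v) x = A x ∧ (f C x == v)

  avail : (Fin (m C) → Bool) → Fin n → ℕ
  avail A v = count (A ∩L v)

  liveDegree : (Fin (m C) → Bool) → Fin n → ℕ
  liveDegree A v = count (λ u → adj G v u ∧ (0 <ᵇ avail A u))

  Admissible : (Fin (m C) → Bool) → Set
  Admissible A = ∀ v → 0 < avail A v → liveDegree A v < avail A v

  record IndependentIn (A I : Fin (m C) → Bool) : Set where
    field
      nonadjacent : Independentᵇ (H C) I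
      within      : ∀ {x} → I x ≡ true → A x ≡ true

  -- covers: Pr(y ∈ I) ≥ 1/|A ∩ L(f y)| for the random set I drawn from family.
  record Covering (A : Fin (m C) → Bool) : Set where
    field
      family   : Family (m C)
      mass-pos : 0 < mass family
      members  : All (IndependentIn A ∘ proj₁) family
      covers   : ∀ {y} → A y ≡ true → mass family ≤ avail A (f C y) * massAt y family

  ∩L-intro : ∀ A {x} → A x ≡ true → (A ∩L f C x) x ≡ true
  ∩L-intro A {x} Ax rewrite Ax = ==-refl (f C x)

  ∩L-⊆ : ∀ A v {x} → (A ∩L v) x ≡ true → A x ≡ true
  ∩L-⊆ A v {x} = ∧-conicalˡ (A x) _

  ∩L-∈ : ∀ A v {x} → (A ∩L v) x ≡ true → f C x ≡ v
  ∩L-∈ A v {x} = ==⇒≡ ∘ ∧-conicalʳ (A x) _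

  avail-pos : ∀ {A x} → A x ≡ true → 0 < avail A (f C x)
  avail-pos {A} {x} Ax = ≤-trans (≤-reflexive (cong 𝟙 (sym (∩L-intro A Ax)))) (≤-sum (𝟙 ∘ (A ∩L f C x)) x)

  avail-mono : ∀ {A A′} → (∀ {x} → A′ x ≡ true → A x ≡ true) → ∀ v → avail A′ v ≤ avail A v
  avail-mono {A} {A′} A′⊆A v = count-mono {P = A′ ∩L v} {Q = A ∩L v} λ x A′∩Lv-x →
    trans (cong (_∧ (f C x == v)) (A′⊆A (∧-conicalˡ (A′ x) _ A′∩Lv-x))) (∧-conicalʳ (A′ x) _ A′∩Lv-x)

  ∅-IndependentIn : ∀ A → IndependentIn A (λ _ → false)
  ∅-IndependentIn A = record { nonadjacent = λ () ; within = λ () }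

  trivial-covering : ∀ A → count A ≡ 0 → Covering A
  trivial-covering A #A≡0 = record
    { family   = ∅-family
    ; mass-pos = s≤s z≤n
    ; members  = ∅-IndependentIn A ∷ []
    ; covers   = λ {y} Ay → case trans (sym Ay) (count≡0 A #A≡0 y) of λ ()
    }

  private
    live-mono : ∀ {a b} c → a ≤ b → (c ∧ (0 <ᵇ a)) ≡ true → (c ∧ (0 <ᵇ b)) ≡ true
    live-mono {suc _} {suc _} c _ live = live
    live-mono {zero} c _ live = case trans (sym live) (∧-zeroʳ c) of λ ()

  liveDegree-mono : ∀ {A A′} → (∀ {x} → A′ x ≡ true → A x ≡ true) →
                    ∀ w → liveDegree A′ w ≤ liveDegree A w
  liveDegree-mono A′⊆A w = sum-mono-≤ λ u → 𝟙-mono (live-mono (adj G w u) (avail-mono A′⊆A u))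

  liveDegree-mono-< : ∀ {A A′} → (∀ {x} → A′ x ≡ true → A x ≡ true) → ∀ {w u} →
                      adj G w u ≡ true → avail A′ u ≡ 0 → 0 < avail A u →
                      liveDegree A′ w < liveDegree A w
  liveDegree-mono-< {A} {A′} A′⊆A {w} {u} w~u dead-u live-u =
    sum-mono-< u (λ u′ → 𝟙-mono (live-mono (adj G w u′) (avail-mono A′⊆A u′))) dead<live
    where
    dead<live : 𝟙 (adj G w u ∧ (0 <ᵇ avail A′ u)) < 𝟙 (adj G w u ∧ (0 <ᵇ avail A u))
    dead<live rewrite w~u | dead-u | Equivalence.to T-≡ (<⇒<ᵇ live-u) = s≤s z≤n

  IndependentIn-insert : ∀ {A A′ I x} → A x ≡ true → (∀ {z} → A′ z ≡ true → A z ≡ true) →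
                         (∀ {z} → A′ z ≡ true → adj (H C) x z ≡ false) →
                         IndependentIn A′ I → IndependentIn A (λ z → (z == x) ∨ I z)
  IndependentIn-insert {A} {A′} {I} {x} Ax A′⊆A x≁A′ I-indep = record
    { nonadjacent = λ {p} {q} p∈ q∈ → nonadjacent′ (∨-≡true (p == x) p∈) (∨-≡true (q == x) q∈)
    ; within      = λ {p} p∈ → within′ (∨-≡true (p == x) p∈)
    }
    where
    open IndependentIn I-indep
    nonadjacent′ : ∀ {p q} → (p == x) ≡ true ⊎ I p ≡ true → (q == x) ≡ true ⊎ I q ≡ true →
                   adj (H C) p q ≡ false
    nonadjacent′ (inj₁ p==x) (inj₁ q==x) = subst₂ (λ p q → adj (H C) p q ≡ false)
                                             (sym (==⇒≡ p==x)) (sym (==⇒≡ q==x)) (irrefl (H C) x)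
    nonadjacent′ (inj₁ p==x) (inj₂ Iq)   = subst (λ p → adj (H C) p _ ≡ false) (sym (==⇒≡ p==x))
                                             (x≁A′ (within Iq))
    nonadjacent′ (inj₂ Ip)   (inj₁ q==x) = subst (λ q → adj (H C) _ q ≡ false) (sym (==⇒≡ q==x))
                                             (trans (Graph.sym (H C) _ x) (x≁A′ (within Ip)))
    nonadjacent′ (inj₂ Ip)   (inj₂ Iq)   = nonadjacent Ip Iq
    within′ : ∀ {p} → (p == x) ≡ true ⊎ I p ≡ true → A p ≡ true
    within′ (inj₁ p==x) = subst (λ p → A p ≡ true) (sym (==⇒≡ p==x)) Ax
    within′ (inj₂ Ip)   = A′⊆A (within Ip)

  module Step (A : Fin (m C) → Bool) (admissible : Admissible A)
              (v : Fin n) (avail≤a : ∀ u → avail A u ≤ avail A v) (0<a : 0 < avail A v)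
              (recurse : ∀ A′ → count A′ < count A → Admissible A′ → Covering A′) where

    a : ℕ
    a = avail A v

    X : Fin (m C) → Bool
    X = A ∩L v

    -- A ∩ L(u) if u ~ v and ∅ otherwise, so that σ u below needs no proof of u ~ v.
    Nbr : Fin n → Fin (m C) → Bool
    Nbr u y = (A ∩L u) y ∧ adj G v u

    Nbr-⊆ : ∀ {u y} → Nbr u y ≡ true → (A ∩L u) y ≡ true
    Nbr-⊆ {u} {y} = ∧-conicalˡ ((A ∩L u) y) _

    Nbr-adj : ∀ {u y} → Nbr u y ≡ true → adj G v u ≡ true
    Nbr-adj {u} {y} = ∧-conicalʳ ((A ∩L u) y) _

    Nbr-intro : ∀ {u y} → (A ∩L u) y ≡ true → adj G v u ≡ true → Nbr u y ≡ true
    Nbr-intro A∩Lu-y v~u rewrite A∩Lu-y | v~u = refl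

    adj⇒≢v : ∀ {u} → adj G v u ≡ true → u ≢ v
    adj⇒≢v v~v refl = case trans (sym v~v) (irrefl G v) of λ ()

    X-Nbr-matching : ∀ u → Matching (adj (H C)) X (Nbr u)
    X-Nbr-matching u = record
      { unique-right = λ {x} {y} {y′} Xx Yy Yy′ →
          matching C x y y′ (apart Xx Yy) (trans (∩L-∈ A u (Nbr-⊆ Yy)) (sym (∩L-∈ A u (Nbr-⊆ Yy′))))
      ; unique-left = λ {x} {x′} {y} Xx Xx′ Yy x~y x′~y →
          matching C y x x′ (apart Xx Yy ∘ sym) (trans (∩L-∈ A v Xx) (sym (∩L-∈ A v Xx′)))
                   (trans (Graph.sym (H C) y x) x~y) (trans (Graph.sym (H C) y x′) x′~y)
      }
      where
      apart : ∀ {x y} → X x ≡ true → Nbr u y ≡ true → f C y ≢ f C x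
      apart Xx Yy fy≡fx = adj⇒≢v (Nbr-adj Yy)
        (trans (sym (∩L-∈ A u (Nbr-⊆ Yy))) (trans fy≡fx (∩L-∈ A v Xx)))

    -- Opaque: unfolding the recursion inside matching-injection swamps every later goal.
    opaque
      injection : ∀ u → ExtendingInjection (adj (H C)) X (Nbr u)
      injection u = matching-injection (adj (H C))
        (≤-trans (count-mono {P = Nbr u} {Q = A ∩L u} λ _ → Nbr-⊆) (avail≤a u)) (X-Nbr-matching u)

    σ : Fin n → Fin (m C) → Fin (m C)
    σ u = ExtendingInjection.σ (injection u)

    A′ : Fin (m C) → Fin (m C) → Bool
    A′ x z = A z ∧ not ((f C z == v) ∨ (adj G v (f C z) ∧ (σ (f C z) z == x)))

    A′⊆A : ∀ x {z} → A′ x z ≡ true → A z ≡ true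
    A′⊆A x {z} = ∧-conicalˡ (A z) _

    A′-off-Lv : ∀ x {z} → f C z ≡ v → A′ x z ≡ false
    A′-off-Lv x {z} fz≡v rewrite fz≡v | ==-refl v = ∧-zeroʳ (A z)

    A′-on-L : ∀ x {z u} → f C z ≡ u → u ≢ v → A′ x z ≡ A z ∧ not (adj G v u ∧ (σ u z == x))
    A′-on-L x fz≡u u≢v rewrite fz≡u | ≢⇒==-false u≢v = refl

    A′-avoids-Lv : ∀ x {z} → A′ x z ≡ true → f C z ≢ v
    A′-avoids-Lv x A′xz fz≡v = case trans (sym A′xz) (A′-off-Lv x fz≡v) of λ ()

    A′-far : ∀ x {y} → A y ≡ true → f C y ≢ v → adj G v (f C y) ≡ false → A′ x y ≡ true
    A′-far x {y} Ay fy≢v v≁fy =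
      trans (A′-on-L x refl fy≢v) (cong₂ (λ p q → p ∧ not (q ∧ (σ (f C y) y == x))) Ay v≁fy)

    A′-near : ∀ x {y} → A y ≡ true → adj G v (f C y) ≡ true → x ≢ σ (f C y) y → A′ x y ≡ true
    A′-near x {y} Ay v~fy x≢σy =
      trans (A′-on-L x refl (adj⇒≢v v~fy))
            (cong₂ (λ p q → p ∧ not q) Ay
                   (trans (cong (_∧ (σ (f C y) y == x)) v~fy) (≢⇒==-false (x≢σy ∘ sym))))

    avail-A′-v : ∀ x → avail (A′ x) v ≡ 0
    avail-A′-v x = sum-zero λ z →
      cong 𝟙 (∧-false-when (A′ x z) (f C z == v) (A′-off-Lv x ∘ ==⇒≡))

    avail-A′-far : ∀ x {u} → adj G v u ≡ false → u ≢ v → avail (A′ x) u ≡ avail A u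
    avail-A′-far x {u} v≁u u≢v = sum-cong-≗ λ z → cong 𝟙 (∧-congˡ-when (f C z == u) λ fz==u →
      trans (A′-on-L x (==⇒≡ fz==u) u≢v)
            (trans (cong (λ q → A z ∧ not (q ∧ (σ u z == x))) v≁u) (∧-identityʳ (A z))))

    hits : Fin n → Fin (m C) → ℕ
    hits u x = count (λ y → Nbr u y ∧ (σ u y == x))

    avail-A′-near : ∀ x {u} → adj G v u ≡ true → avail (A′ x) u + hits u x ≡ avail A u
    avail-A′-near x {u} v~u = trans (sym (∑-distrib-+ (𝟙 ∘ (A′ x ∩L u)) _)) (sum-cong-≗ split)
      where
      partition : ∀ p q s → 𝟙 ((p ∧ not s) ∧ q) + 𝟙 (((p ∧ q) ∧ true) ∧ s) ≡ 𝟙 (p ∧ q)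
      partition false _     _     = refl
      partition true  false false = refl
      partition true  false true  = refl
      partition true  true  false = refl
      partition true  true  true  = refl
      split : ∀ z → 𝟙 ((A′ x ∩L u) z) + 𝟙 (Nbr u z ∧ (σ u z == x)) ≡ 𝟙 ((A ∩L u) z)
      split z = begin
        𝟙 (A′ x z ∧ (f C z == u)) + 𝟙 (((A z ∧ (f C z == u)) ∧ adj G v u) ∧ (σ u z == x))
          ≡⟨ cong₂ (λ p q → 𝟙 p + 𝟙 (((A z ∧ (f C z == u)) ∧ q) ∧ (σ u z == x))) A′∩L≡ v~u ⟩
        𝟙 ((A z ∧ not (σ u z == x)) ∧ (f C z == u)) + 𝟙 (((A z ∧ (f C z == u)) ∧ true) ∧ (σ u z == x))
          ≡⟨ partition (A z) (f C z == u) (σ u z == x) ⟩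
        𝟙 (A z ∧ (f C z == u)) ∎
        where
        open ≡-Reasoning
        A′∩L≡ : (A′ x z ∧ (f C z == u)) ≡ ((A z ∧ not (σ u z == x)) ∧ (f C z == u))
        A′∩L≡ = ∧-congˡ-when (f C z == u) λ fz==u →
          trans (A′-on-L x (==⇒≡ fz==u) (adj⇒≢v v~u)) (cong (λ q → A z ∧ not (q ∧ (σ u z == x))) v~u)

    module I u = ExtendingInjection (injection u)

    hits≤1 : ∀ u x → hits u x ≤ 1
    hits≤1 u x = count≤1 (λ y → Nbr u y ∧ (σ u y == x)) λ y y′ y↦x y′↦x →
      I.σ-injective u (∧-conicalˡ (Nbr u y) _ y↦x) (∧-conicalˡ (Nbr u y′) _ y′↦x)
        (trans (==⇒≡ (∧-conicalʳ (Nbr u y) _ y↦x)) (sym (==⇒≡ (∧-conicalʳ (Nbr u y′) _ y′↦x))))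

    hits-σ : ∀ {u y} → Nbr u y ≡ true → hits u (σ u y) ≡ 1
    hits-σ {u} {y} Nbr-uy = ≤-antisym (hits≤1 u (σ u y))
      (≤-trans (≤-reflexive (cong₂ (λ p q → 𝟙 (p ∧ q)) (sym Nbr-uy) (sym (==-refl (σ u y)))))
               (≤-sum (λ y′ → 𝟙 (Nbr u y′ ∧ (σ u y′ == σ u y))) y))

    sum-hits : ∀ {u} → adj G v u ≡ true → sum (λ x → 𝟙 (X x) * hits u x) ≡ avail A u
    sum-hits {u} v~u = trans (sum-fibres X (Nbr u) (σ u) (I.σ-into u))
      (sum-cong-≗ λ y → cong 𝟙 (trans (cong ((A ∩L u) y ∧_) v~u) (∧-identityʳ ((A ∩L u) y))))

    A′-shrinks : ∀ x → count (A′ x) < count A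
    A′-shrinks x with count-witness X 0<a
    ... | w , Xw = sum-mono-< w (λ z → 𝟙-mono (A′⊆A x))
      (subst₂ (λ p q → 𝟙 p < 𝟙 q) (sym (A′-off-Lv x (∩L-∈ A v Xw))) (sym (∩L-⊆ A v Xw)) (s≤s z≤n))

    A′-admissible : ∀ x → Admissible (A′ x)
    A′-admissible x w 0<avail′ with adj G v w in v~w
    ... | true = ≤-pred (begin
      suc (suc (liveDegree (A′ x) w)) ≤⟨ s≤s (liveDegree-mono-< (A′⊆A x) w~v (avail-A′-v x) 0<a) ⟩
      suc (liveDegree A w)             ≤⟨ admissible w 0<avail ⟩
      avail A w                        ≡⟨ sym (avail-A′-near x v~w) ⟩
      avail (A′ x) w + hits w x        ≤⟨ +-monoʳ-≤ (avail (A′ x) w) (hits≤1 w x) ⟩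
      avail (A′ x) w + 1               ≡⟨ +-comm (avail (A′ x) w) 1 ⟩
      suc (avail (A′ x) w)             ∎)
      where
      open ≤-Reasoning
      w~v = trans (Graph.sym G w v) v~w
      0<avail = ≤-trans 0<avail′ (avail-mono (A′⊆A x) w)
    ... | false = begin-strict
      liveDegree (A′ x) w ≤⟨ liveDegree-mono (A′⊆A x) w ⟩
      liveDegree A w      <⟨ admissible w 0<avail ⟩
      avail A w           ≡⟨ sym (avail-A′-far x v~w w≢v) ⟩
      avail (A′ x) w      ∎
      where
      open ≤-Reasoning
      0<avail = ≤-trans 0<avail′ (avail-mono (A′⊆A x) w)
      w≢v : w ≢ v
      w≢v refl = <-irrefl (sym (avail-A′-v x)) 0<avail′

    A′-σ≢ : ∀ x {z} → A′ x z ≡ true → adj G v (f C z) ≡ true → σ (f C z) z ≢ x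
    A′-σ≢ x {z} A′xz v~fz σz≡x = case trans (sym A′xz) removed of λ ()
      where
      removed : A′ x z ≡ false
      removed = begin
        A′ x z                                             ≡⟨ A′-on-L x refl (A′-avoids-Lv x A′xz) ⟩
        A z ∧ not (adj G v (f C z) ∧ (σ (f C z) z == x))  ≡⟨ cong₂ (λ p q → A z ∧ not (p ∧ q)) v~fz
                                                                   (trans (cong (_== x) σz≡x) (==-refl x)) ⟩
        A z ∧ false                                        ≡⟨ ∧-zeroʳ (A z) ⟩
        false                                              ∎
        where open ≡-Reasoning

    x≁A′ : ∀ {x z} → X x ≡ true → A′ x z ≡ true → adj (H C) x z ≡ false
    x≁A′ {x} {z} Xx A′xz = by-cases (adj G v (f C z)) refl
      where
      by-cases : ∀ b → adj G v (f C z) ≡ b → adj (H C) x z ≡ false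
      by-cases false v≁fz = nonadj C x z (λ fx≡fz → A′-avoids-Lv x A′xz (trans (sym fx≡fz) (∩L-∈ A v Xx)))
                               (subst (λ w → adj G w (f C z) ≡ false) (sym (∩L-∈ A v Xx)) v≁fz)
      by-cases true  v~fz = ¬-not λ x~z → A′-σ≢ x A′xz v~fz
                               (I.σ-extends (f C z) Xx (Nbr-intro (∩L-intro A (A′⊆A x A′xz)) v~fz) x~z)

    -- For x ∉ X the branch gets weight 0 in the mixture, so any family will do.
    record Branch (x : Fin (m C)) : Set where
      field
        family   : Family (m C)
        mass-pos : 0 < mass family
        members  : All (IndependentIn A ∘ proj₁) family
        covers-x : X x ≡ true → mass family ≤ massAt x family
        covers   : X x ≡ true → ∀ {y} → A′ x y ≡ true →
                   mass family ≤ avail (A′ x) (f C y) * massAt y family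

    branch : ∀ x → Branch x
    branch x with X x in Xx
    ... | true = record
      { family   = insert x F
      ; mass-pos = subst (0 <_) (sym (mass-insert x F)) mass-pos
      ; members  = All.map⁺ (All.map (IndependentIn-insert (∩L-⊆ A v Xx) (A′⊆A x) (x≁A′ Xx)) members)
      ; covers-x = λ _ → ≤-reflexive (trans (mass-insert x F) (sym (massAt-insert-self x F)))
      ; covers   = λ _ {y} A′xy → begin
          mass (insert x F)                            ≡⟨ mass-insert x F ⟩
          mass F                                       ≤⟨ covers A′xy ⟩
          avail (A′ x) (f C y) * massAt y F
            ≤⟨ *-monoʳ-≤ (avail (A′ x) (f C y)) (massAt-insert-mono x y F) ⟩
          avail (A′ x) (f C y) * massAt y (insert x F) ∎
      }
      where
      open Covering (recurse (A′ x) (A′-shrinks x) (A′-admissible x)) renaming (family to F)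
      open ≤-Reasoning
    ... | false = record
      { family   = ∅-family
      ; mass-pos = s≤s z≤n
      ; members  = ∅-IndependentIn A ∷ []
      ; covers-x = λ Xx′ → case trans (sym Xx′) Xx of λ ()
      ; covers   = λ Xx′ → case trans (sym Xx′) Xx of λ ()
      }

    Fs : Fin (m C) → Family (m C)
    Fs x = Branch.family (branch x)

    l : Fin (m C) → ℕ
    l x = 𝟙 (X x)

    S : ℕ
    S = Π-mass Fs

    mixture : Family (m C)
    mixture = mix l Fs

    covers-Lv : ∀ {y} → X y ≡ true → S * a ≤ a * massAt y mixture
    covers-Lv {y} Xy = begin
      S * a                              ≡⟨ *-comm S a ⟩
      a * S                              ≡˘⟨ cong (a *_) (*-identityʳ S) ⟩
      a * (S * 1)                        ≡˘⟨ cong (λ k → a * (S * k)) picks-y ⟩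
      a * (S * sum (λ x → l x * e x))    ≤⟨ *-monoʳ-≤ a (massAt-mix l e Fs y 1 bound) ⟩
      a * (1 * massAt y mixture)         ≡⟨ cong (a *_) (*-identityˡ (massAt y mixture)) ⟩
      a * massAt y mixture               ∎
      where
      open ≤-Reasoning
      e : Fin (m C) → ℕ
      e x = 𝟙 (x == y)
      picks-y : sum (λ x → l x * e x) ≡ 1
      picks-y = trans (sum-supported _ y λ x x≢y → cong (λ b → l x * 𝟙 b) (≢⇒==-false x≢y) ■ *-zeroʳ (l x))
                      (cong₂ (λ p q → 𝟙 p * 𝟙 q) Xy (==-refl y))
        where _■_ = trans
      bound : ∀ x → 0 < l x → e x * mass (Fs x) ≤ 1 * massAt y (Fs x)
      bound x 0<lx with x ≟ y
      ... | yes refl = *-monoʳ-≤ 1 (Branch.covers-x (branch x) (𝟙-pos 0<lx))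
      ... | no _     = z≤n

    covers-far : ∀ {y} → A y ≡ true → f C y ≢ v → adj G v (f C y) ≡ false →
                 S * a ≤ avail A (f C y) * massAt y mixture
    covers-far {y} Ay fy≢v v≁fy = begin
      S * a                           ≡˘⟨ cong (S *_) (sum-cong-≗ (𝟙-idem ∘ X)) ⟩
      S * sum (λ x → l x * l x)       ≤⟨ massAt-mix l l Fs y (avail A (f C y)) bound ⟩
      avail A (f C y) * massAt y mixture ∎
      where
      open ≤-Reasoning
      bound : ∀ x → 0 < l x → l x * mass (Fs x) ≤ avail A (f C y) * massAt y (Fs x)
      bound x 0<lx = begin
        l x * mass (Fs x)                      ≡⟨ cong (λ b → 𝟙 b * mass (Fs x)) (𝟙-pos 0<lx) ⟩
        1 * mass (Fs x)                        ≡⟨ *-identityˡ (mass (Fs x)) ⟩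
        mass (Fs x)                            ≤⟨ Branch.covers (branch x) (𝟙-pos 0<lx) (A′-far x Ay fy≢v v≁fy) ⟩
        avail (A′ x) (f C y) * massAt y (Fs x) ≤⟨ *-monoˡ-≤ (massAt y (Fs x)) (avail-mono (A′⊆A x) (f C y)) ⟩
        avail A (f C y) * massAt y (Fs x)      ∎

    covers-near : ∀ {y} → A y ≡ true → adj G v (f C y) ≡ true →
                  S * a ≤ avail A (f C y) * massAt y mixture
    covers-near {y} Ay v~u = *-cancelˡ-≤ b₁ {{>-nonZero 0<b₁}} (begin
      b₁ * (S * a)                ≡⟨ x∙yz≈y∙xz b₁ S a ⟩
      S * (b₁ * a)                ≡˘⟨ cong (S *_) weights-sum ⟩
      S * sum (λ x → l x * e x)   ≤⟨ massAt-mix l e Fs y (b * b₁) bound ⟩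
      b * b₁ * massAt y mixture   ≡⟨ trans (cong (_* massAt y mixture) (*-comm b b₁)) (*-assoc b₁ b _) ⟩
      b₁ * (b * massAt y mixture) ∎)
      where
      open ≤-Reasoning
      u = f C y
      b = avail A u
      s = σ u y

      Nbr-uy : Nbr u y ≡ true
      Nbr-uy = Nbr-intro (∩L-intro A Ay) v~u

      v-live : 1 ≤ liveDegree A u
      v-live = ≤-trans (≤-reflexive (cong 𝟙 (sym (cong₂ _∧_ (trans (Graph.sym G u v) v~u)
                                                           (Equivalence.to T-≡ (<⇒<ᵇ 0<a))))))
                       (≤-sum (λ w → 𝟙 (adj G u w ∧ (0 <ᵇ avail A w))) v)

      1<b : 1 < b
      1<b = ≤-trans (s≤s v-live) (admissible u (avail-pos Ay))

      b₁ = pred b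

      b≡1+b₁ : b ≡ suc b₁
      b≡1+b₁ = sym (suc-pred b {{>-nonZero (≤-trans (s≤s z≤n) 1<b)}})

      0<b₁ : 0 < b₁
      0<b₁ = ≤-pred (subst (1 <_) b≡1+b₁ 1<b)

      -- Branch x ≠ s gives y probability ≥ 1/(b − hits u x) = (b₁ + hits u x)/(b·b₁).
      e : Fin (m C) → ℕ
      e x = 𝟙 (not (x == s)) * (b₁ + hits u x)

      bound : ∀ x → 0 < l x → e x * mass (Fs x) ≤ b * b₁ * massAt y (Fs x)
      bound x 0<lx with x ≟ s
      ... | yes _   = z≤n
      ... | no x≢s = begin
        1 * (b₁ + hits u x) * mass (Fs x) ≡⟨ cong (_* mass (Fs x)) (*-identityˡ (b₁ + hits u x)) ⟩
        (b₁ + hits u x) * mass (Fs x)     ≤⟨ reciprocal-bound (trans (avail-A′-near x v~u) b≡1+b₁) (hits≤1 u x)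
                                               (Branch.covers (branch x) (𝟙-pos 0<lx) (A′-near x Ay v~u x≢s)) ⟩
        suc b₁ * b₁ * massAt y (Fs x)     ≡˘⟨ cong (λ k → k * b₁ * massAt y (Fs x)) b≡1+b₁ ⟩
        b * b₁ * massAt y (Fs x)          ∎

      g : Fin (m C) → ℕ
      g x = l x * (b₁ + hits u x)

      sum-g : sum g ≡ b₁ * a + b
      sum-g = begin-equality
        sum g
          ≡⟨ sum-cong-≗ (λ x → *-distribˡ-+ (l x) b₁ (hits u x)) ⟩
        sum (λ x → l x * b₁ + l x * hits u x)
          ≡⟨ ∑-distrib-+ (λ x → l x * b₁) (λ x → l x * hits u x) ⟩
        sum (λ x → l x * b₁) + sum (λ x → l x * hits u x)
          ≡⟨ cong₂ _+_ (sum-cong-≗ (λ x → *-comm (l x) b₁)) (sum-hits v~u) ⟩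
        sum (λ x → b₁ * l x) + b
          ≡˘⟨ cong (_+ b) (*-distribˡ-sum b₁ l) ⟩
        b₁ * a + b ∎

      g-s : g s ≡ b
      g-s = begin-equality
        l s * (b₁ + hits u s) ≡⟨ cong₂ (λ p h → 𝟙 p * (b₁ + h)) (I.σ-into u Nbr-uy) (hits-σ Nbr-uy) ⟩
        1 * (b₁ + 1)          ≡⟨ trans (*-identityˡ (b₁ + 1)) (+-comm b₁ 1) ⟩
        suc b₁                ≡˘⟨ b≡1+b₁ ⟩
        b                     ∎

      weights-sum : sum (λ x → l x * e x) ≡ b₁ * a
      weights-sum = +-cancelˡ-≡ b _ _ (begin-equality
        b + sum (λ x → l x * e x)
          ≡⟨ cong (b +_) (sum-cong-≗ λ x → x∙yz≈y∙xz (l x) (𝟙 (not (x == s))) _) ⟩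
        b + sum (λ x → 𝟙 (not (x == s)) * g x)    ≡˘⟨ cong (_+ sum (λ x → 𝟙 (not (x == s)) * g x)) g-s ⟩
        g s + sum (λ x → 𝟙 (not (x == s)) * g x)  ≡˘⟨ sum-split-at g s ⟩
        sum g                                      ≡⟨ sum-g ⟩
        b₁ * a + b                                 ≡⟨ +-comm (b₁ * a) b ⟩
        b + b₁ * a                                 ∎)

    covering-step : Covering A
    covering-step = record
      { family   = mixture
      ; mass-pos = subst (0 <_) (sym (mass-mix l Fs)) (*-mono-< (Π-mass-pos Fs (Branch.mass-pos ∘ branch)) 0<a)
      ; members  = All-mix l Fs (Branch.members ∘ branch)
      ; covers   = λ {y} Ay → subst (_≤ avail A (f C y) * massAt y mixture) (sym (mass-mix l Fs)) (covers′ Ay)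
      }
      where
      covers′ : ∀ {y} → A y ≡ true → S * a ≤ avail A (f C y) * massAt y mixture
      covers′ {y} Ay with f C y ≟ v
      ... | yes fy≡v = subst (λ w → S * a ≤ avail A w * massAt y mixture) (sym fy≡v)
                         (covers-Lv (subst (λ w → (A ∩L w) y ≡ true) fy≡v (∩L-intro A Ay)))
      ... | no fy≢v  = by-cases (adj G v (f C y)) refl
        where
        by-cases : ∀ b → adj G v (f C y) ≡ b → S * a ≤ avail A (f C y) * massAt y mixture
        by-cases true  v~fy = covers-near Ay v~fy
        by-cases false v≁fy = covers-far Ay fy≢v v≁fy

  covering : ∀ A → Admissible A → Covering A
  covering A = go (count A) A ≤-refl
    where
    go : ∀ k A → count A ≤ k → Admissible A → Covering A
    go zero    A #A≤0   _          = trivial-covering A (n≤0⇒n≡0 #A≤0)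
    go (suc k) A #A≤1+k admissible with empty-or-element A
    ... | inj₁ #A≡0       = trivial-covering A #A≡0
    ... | inj₂ (z₀ , Az₀) =
      Step.covering-step A admissible v avail≤a (≤-trans (avail-pos Az₀) (avail≤a (f C z₀))) recurse
      where
      v = argmax (avail A) (f C z₀) (allFin n)
      avail≤a : ∀ u → avail A u ≤ avail A v
      avail≤a u = All.lookup (f[xs]≤f[argmax] {f = avail A} (f C z₀) (allFin n)) (∈-allFin u)
      recurse : ∀ A′ → count A′ < count A → Admissible A′ → Covering A′
      recurse A′ #A′<#A = go k A′ (≤-pred (≤-trans #A′<#A #A≤1+k))

  everything : Fin (m C) → Bool
  everything _ = true

  size≡avail : ∀ v → size C v ≡ avail everything v
  size≡avail v = length-filter-tabulate (λ x → x) (λ x → f C x ≟ v)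

  deg≡liveDegree : (∀ v → 0 < size C v) → ∀ v → deg G v ≡ liveDegree everything v
  deg≡liveDegree size-pos v =
    trans (length-filter-tabulate (λ u → u) (λ u → adj G v u ≟ᵇ true)) (sum-cong-≗ λ u → cong 𝟙 (live u))
    where
    live : ∀ u → does (adj G v u ≟ᵇ true) ≡ (adj G v u ∧ (0 <ᵇ avail everything u))
    live u with adj G v u
    ... | false = refl
    ... | true  = sym (Equivalence.to T-≡ (<⇒<ᵇ (subst (0 <_) (size≡avail u) (size-pos u))))

  everything-covering : (∀ v → suc (deg G v) ≤ size C v) → Covering everything
  everything-covering deg<size = covering everything admissible
    where
    admissible : Admissible everything
    admissible v _ = subst₂ _≤_ (cong suc (deg≡liveDegree (λ u → ≤-trans (s≤s z≤n) (deg<size u)) v))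
                                (size≡avail v) (deg<size v)

  covers-size : (K : Covering everything) → ∀ {v x} → f C x ≡ v →
                mass (Covering.family K) ≤ size C v * massAt x (Covering.family K)
  covers-size K {x = x} refl =
    subst (λ k → mass F ≤ k * massAt x F) (sym (size≡avail (f C x))) (Covering.covers K refl)
    where F = Covering.family K

open import Data.Nat using (suc) renaming (_≤_ to _≤ℕ_)
open import Data.Fin using (Fin)
open import Data.Integer using (+_)
open import Data.Product using (Σ; _,_; proj₁)
open import Data.Rational using (_/_; _≤_; _*_; 1ℚ)
open import Relation.Binary.PropositionalEquality using (_≡_)
open import Data.List.Relation.Unary.All as All using (All)
open import Function using (_∘_)
open Normalisation using (Independentᵇ; distribution; distribution-Pr∈)

lemma18 : ∀ {n} (G : Graph n) (C : Cover G) →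
    (∀ v → suc (deg G v) ≤ℕ size C v) →
    Σ (Distribution (H C)) (λ D →
    ∀ (v : Fin n) (x : Fin (m C)) → f C x ≡ v →
    1ℚ ≤ ((+ size C v) / 1) * Pr∈ D x)
lemma18 G C deg<size = D , λ v x fx≡v →
  distribution-Pr∈ {H = H C} family mass-pos members-independent {x} {size C v} (covers-size K fx≡v)
  where
  open Construction G C
  K = everything-covering deg<size
  open Covering K
  members-independent : All (Independentᵇ (H C) ∘ proj₁) family
  members-independent = All.map IndependentIn.nonadjacent members
  D : Distribution (H C)
  D = distribution family mass-pos members-independent
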